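{- The class of threshold graphs is degree sandwich monotone; that is, for every threshold graph $G$ and every set $F\subseteq E(G)$ such that $G-F$ is threshold, every degree-minimal edge $e$ in $F$ satisfies that $G-e$ is threshold.
   Context: A graph $G=(V,E)$ is threshold if there exist $\ell:V\to\mathbb{N}_0$ and $t\in\mathbb{N}_0$ such that $X\subseteq V$ is independent iff $\sum_{x\in X}\ell(x)\le t$. For $F\subseteq E(G)$, an edge $uv\in F$ is degree-minimal in $F$ if (i) $u$ has the smallest degree in $G$ among all vertices incident to an edge of $F$, and (ii) $d_G(v)$ is smallest among all vertices $w$ with $uw\in F$. -}

module Defs where

open import Data.Nat using (ℕ; _≤_)
open import Data.Bool using (Bool; true; false; if_then_else_; _∧_; not)
open import Data.Fin using (Fin; _≟_)
open import Data.Fin.Subset using (Subset; _∈_)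
open import Data.List using (List; map; allFin)
open import Data.Nat.ListAction using (sum)
open import Data.Vec using (lookup)
open import Data.Product using (Σ; _×_)
open import Function.Bundles using (_⇔_)
open import Relation.Binary.PropositionalEquality using (_≡_)
open import Relation.Nullary.Decidable using (⌊_⌋)

record Graph (n : ℕ) : Set where
  field
    adj    : Fin n → Fin n → Bool
    sym    : ∀ u v → adj u v ≡ adj v u
    irrefl : ∀ u → adj u u ≡ false
open Graph public

deg : ∀ {n} → Graph n → Fin n → ℕ
deg {n} G u = sum (map (λ v → if adj G u v then 1 else 0) (allFin n))

Independent : ∀ {n} → Graph n → Subset n → Set
Independent G X = ∀ u v → u ∈ X → v ∈ X → adj G u v ≡ false

weight : ∀ {n} → (Fin n → ℕ) → Subset n → ℕ
weight {n} ℓ X = sum (map (λ v → if lookup X v then ℓ v else 0) (allFin n))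

Threshold : ∀ {n} → Graph n → Set
Threshold {n} G =
  Σ (Fin n → ℕ) λ ℓ → Σ ℕ λ t → ∀ (X : Subset n) → Independent G X ⇔ (weight ℓ X ≤ t)

record EdgeSet {n} (G : Graph n) : Set where
  field
    mem    : Fin n → Fin n → Bool
    memSym : ∀ u v → mem u v ≡ mem v u
    sub    : ∀ u v → mem u v ≡ true → adj G u v ≡ true
open EdgeSet public

delete : ∀ {n} (G : Graph n) → EdgeSet G → Graph n
delete G F = record
  { adj    = λ u v → adj G u v ∧ not (mem F u v)
  ; sym    = λ u v → aux u v
  ; irrefl = λ u → irr u
  }
  where
  open import Relation.Binary.PropositionalEquality using (cong₂; cong)
  aux : ∀ u v → (adj G u v ∧ not (mem F u v)) ≡ (adj G v u ∧ not (mem F v u))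
  aux u v = cong₂ _∧_ (Graph.sym G u v) (cong not (memSym F u v))
  irr : ∀ u → (adj G u u ∧ not (mem F u u)) ≡ false
  irr u with adj G u u | Graph.irrefl G u
  ... | .false | _≡_.refl = _≡_.refl

deleteEdge : ∀ {n} (G : Graph n) (u v : Fin n) → Graph n
deleteEdge G u v = record
  { adj    = λ x y → adj G x y ∧ not (⌊ x ≟ u ⌋ ∧ ⌊ y ≟ v ⌋ ∨' ⌊ x ≟ v ⌋ ∧ ⌊ y ≟ u ⌋)
  ; sym    = λ x y → aux x y
  ; irrefl = λ x → irr x
  }
  where
  open import Data.Bool using (_∨_)
  open import Data.Bool.Properties using (∨-comm)
  open import Relation.Binary.PropositionalEquality using (cong₂; cong)
  _∨'_ = _∨_
  infixr 5 _∨'_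
  aux : ∀ x y → (adj G x y ∧ not (⌊ x ≟ u ⌋ ∧ ⌊ y ≟ v ⌋ ∨ ⌊ x ≟ v ⌋ ∧ ⌊ y ≟ u ⌋))
              ≡ (adj G y x ∧ not (⌊ y ≟ u ⌋ ∧ ⌊ x ≟ v ⌋ ∨ ⌊ y ≟ v ⌋ ∧ ⌊ x ≟ u ⌋))
  aux x y = cong₂ _∧_ (Graph.sym G x y) (cong not (
    Relation.Binary.PropositionalEquality.trans
      (∨-comm (⌊ x ≟ u ⌋ ∧ ⌊ y ≟ v ⌋) (⌊ x ≟ v ⌋ ∧ ⌊ y ≟ u ⌋))
      (cong₂ _∨_ (Data.Bool.Properties.∧-comm ⌊ x ≟ v ⌋ ⌊ y ≟ u ⌋)
                 (Data.Bool.Properties.∧-comm ⌊ x ≟ u ⌋ ⌊ y ≟ v ⌋))))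
    where import Relation.Binary.PropositionalEquality
          import Data.Bool.Properties
  irr : ∀ x → (adj G x x ∧ not (⌊ x ≟ u ⌋ ∧ ⌊ x ≟ v ⌋ ∨ ⌊ x ≟ v ⌋ ∧ ⌊ x ≟ u ⌋)) ≡ false
  irr x with adj G x x | Graph.irrefl G x
  ... | .false | _≡_.refl = _≡_.refl

DegreeMinimal : ∀ {n} (G : Graph n) (F : EdgeSet G) (u v : Fin n) → Set
DegreeMinimal G F u v =
  (mem F u v ≡ true)
  × (∀ x y → mem F x y ≡ true → deg G u ≤ deg G x)
  × (∀ w → mem F u w ≡ true → deg G v ≤ deg G w)

{-# OPTIONS --safe #-}

-- A graph is threshold iff it has no alternating 4-cycle: vertices a, b, c, d with ab, cd
-- edges, ac, bd non-edges, a ≠ c and b ≠ d (each of 2K₂, P₄, C₄ contains one).  Without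
-- such cycles neighbourhoods are nested along the degree order: deg x ≤ deg y implies
-- N(x) ∖ {y} ⊆ N(y).
-- Let uv ∈ F be degree-minimal.  An alternating 4-cycle of G − uv that is not one of G has
-- uv as a non-edge: ub, vd are edges and bd is not.  If ub ∈ F then deg v ≤ deg b, so the
-- neighbour d of v is adjacent to b; if vd ∈ F then deg u ≤ deg d, so the neighbour b of u
-- is adjacent to d; otherwise u, b, v, d is an alternating 4-cycle of G − F.

module Submission where

open import Defs renaming (sym to adj-sym)
open import Data.Bool using (true; false; if_then_else_)
import Data.Bool.Properties as Bool
open import Data.Empty using (⊥; ⊥-elim)
open import Data.Fin using (Fin; _≟_)
open import Data.Fin.Properties using (any?)
open import Data.List using (map; allFin; tabulate)
open import Data.List.Properties using (map-tabulate)
import Data.Nat.ListAction as List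
open import Data.Nat using (ℕ; zero; suc; _+_; _*_; _∸_; _^_; _≤_; _<_; _≤?_; z≤n)
open import Data.Nat.Properties hiding (_≟_)
open import Algebra.Properties.CommutativeMonoid.Sum +-0-commutativeMonoid
  using (sum; sum-cong-≗; sum-replicate-zero; ∑-distrib-+)
open import Algebra.Properties.CommutativeSemigroup +-commutativeSemigroup using (interchange)
open import Data.Product using (_×_; _,_; proj₁; proj₂; ∃-syntax)
open import Data.Sum as Sum using (_⊎_; inj₁; inj₂)
open import Data.Fin.Subset using (Subset; _∈_; _⊆_; ⁅_⁆; _∪_)
open import Data.Fin.Subset.Properties using (_∈?_; x∈⁅x⁆; x∈⁅y⁆⇒x≡y; x∈p∪q⁻; x∈p∪q⁺)
open import Data.Vec using (lookup)
open import Data.Vec.Properties using ([]=⇒lookup; lookup⇒[]=)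
open import Function.Bundles using (mk⇔; Equivalence)
open import Function.Base using (_∘_)
open import Relation.Binary.PropositionalEquality
open import Relation.Nullary using (Dec; yes; no; ¬_; ¬?; _×-dec_)
open import Relation.Nullary.Decidable using (⌊_⌋; decidable-stable)
open import Relation.Nullary.Negation using (contradiction)

≡true⇒≢false : ∀ {b} → b ≡ true → b ≢ false
≡true⇒≢false refl ()

sum-allFin : ∀ {n} (f : Fin n → ℕ) → List.sum (map f (allFin n)) ≡ sum f
sum-allFin f = trans (cong List.sum (map-tabulate (λ i → i) f)) (sum-tabulate f)
  where
  sum-tabulate : ∀ {n} (f : Fin n → ℕ) → List.sum (tabulate f) ≡ sum f
  sum-tabulate {zero}  f = refl
  sum-tabulate {suc n} f = cong (f Fin.zero +_) (sum-tabulate (f ∘ Fin.suc))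

sum-mono-≤ : ∀ {n} {f g : Fin n → ℕ} → (∀ i → f i ≤ g i) → sum f ≤ sum g
sum-mono-≤ {zero}  f≤g = z≤n
sum-mono-≤ {suc n} f≤g = +-mono-≤ (f≤g Fin.zero) (sum-mono-≤ (f≤g ∘ Fin.suc))

sum-≤-* : ∀ {n} {f : Fin n → ℕ} {c} → (∀ i → f i ≤ c) → sum f ≤ n * c
sum-≤-* {zero}  f≤c = z≤n
sum-≤-* {suc n} f≤c = +-mono-≤ (f≤c Fin.zero) (sum-≤-* (f≤c ∘ Fin.suc))

sum-<-^ : ∀ {n} {f : Fin n → ℕ} {d} → (∀ i → f i ≤ suc n ^ d) → sum f < suc n ^ suc d
sum-<-^ {n} {d = d} f≤ = ≤-<-trans (sum-≤-* f≤) (*-monoˡ-< (suc n ^ d) {{m^n≢0 (suc n) d}} (n<1+n n))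

point : ∀ {n} → Fin n → ℕ → Fin n → ℕ
point a c i = if ⌊ i ≟ a ⌋ then c else 0

point-≡ : ∀ {n} (a : Fin n) c → point a c a ≡ c
point-≡ a c with a ≟ a
... | yes _   = refl
... | no a≢a  = contradiction refl a≢a

point-≢ : ∀ {n} {a i : Fin n} c → i ≢ a → point a c i ≡ 0
point-≢ {a = a} {i} c i≢a with i ≟ a
... | yes i≡a = contradiction i≡a i≢a
... | no _    = refl

sum-point : ∀ {n} (a : Fin n) c → sum (point a c) ≡ c
sum-point {suc n} Fin.zero    c = trans (cong (c +_) (sum-replicate-zero n)) (+-identityʳ c)
sum-point {suc n} (Fin.suc a) c = trans (sum-cong-≗ {n} point-suc) (sum-point a c)
  where
  point-suc : ∀ i → point (Fin.suc a) c (Fin.suc i) ≡ point a c i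
  point-suc i with i ≟ a
  ... | yes _ = refl
  ... | no _  = refl

adjacency : ∀ {n} → Graph n → Fin n → Fin n → ℕ
adjacency G x z = if adj G x z then 1 else 0

deg-sum : ∀ {n} (G : Graph n) x → deg G x ≡ sum (adjacency G x)
deg-sum G x = sum-allFin (adjacency G x)

adj-flip : ∀ {n} (G : Graph n) {x y b} → adj G x y ≡ b → adj G y x ≡ b
adj-flip G {x} {y} e = trans (adj-sym G y x) e

adj⇒≢ : ∀ {n} (G : Graph n) {x y} → adj G x y ≡ true → x ≢ y
adj⇒≢ G {x} xy refl = ≡true⇒≢false xy (irrefl G x)

adjacency-mono : ∀ {n} (G : Graph n) {x y z} → (adj G y z ≡ true → adj G x z ≡ true)
               → adjacency G y z ≤ adjacency G x z
adjacency-mono G {x} {y} {z} N[y]⊆N[x] with adj G y z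
... | false = z≤n
... | true rewrite N[y]⊆N[x] refl = ≤-refl

adj⇒deg>0 : ∀ {n} (G : Graph n) {x y} → adj G x y ≡ true → 0 < deg G x
adj⇒deg>0 G {x} {y} xy = begin
  1                       ≡⟨ sum-point y 1 ⟨
  sum (point y 1)         ≤⟨ sum-mono-≤ point≤adjacency ⟩
  sum (adjacency G x)     ≡⟨ deg-sum G x ⟨
  deg G x                 ∎
  where
  open ≤-Reasoning
  point≤adjacency : ∀ z → point y 1 z ≤ adjacency G x z
  point≤adjacency z with z ≟ y
  ... | yes refl rewrite xy = ≤-refl
  ... | no _ = z≤n

neighbours-⊂⇒deg< : ∀ {n} (G : Graph n) {x y w} → adj G x w ≡ true → adj G y w ≡ false → w ≢ y
           → (∀ z → z ≢ x → adj G y z ≡ true → adj G x z ≡ true) → deg G y < deg G x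
neighbours-⊂⇒deg< G {x} {y} {w} xw yw w≢y N[y]⊆N[x] = +-cancelʳ-≤ c (suc (deg G y)) (deg G x) (begin
  suc (deg G y) + c
    ≡⟨ cong₂ _+_ (cong₂ _+_ (sym (sum-point w 1)) (deg-sum G y)) (sym (sum-point y c)) ⟩
  sum (point w 1) + sum (adjacency G y) + sum (point y c)
    ≡⟨ cong (_+ sum (point y c)) (∑-distrib-+ (point w 1) (adjacency G y)) ⟨
  sum (λ z → point w 1 z + adjacency G y z) + sum (point y c)
    ≡⟨ ∑-distrib-+ (λ z → point w 1 z + adjacency G y z) (point y c) ⟨
  sum (λ z → point w 1 z + adjacency G y z + point y c z)
    ≤⟨ sum-mono-≤ pointwise ⟩
  sum (λ z → adjacency G x z + point x c z)
    ≡⟨ ∑-distrib-+ (adjacency G x) (point x c) ⟩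
  sum (adjacency G x) + sum (point x c)
    ≡⟨ cong₂ _+_ (sym (deg-sum G x)) (sum-point x c) ⟩
  deg G x + c ∎)
  where
  open ≤-Reasoning
  -- x ∈ N(y) exactly when y ∈ N(x); the point masses of size c account for both.
  c = adjacency G x y
  w≢x : w ≢ x
  w≢x = adj⇒≢ G (adj-flip G xw)
  x≢y : x ≢ y
  x≢y refl = ≡true⇒≢false xw yw
  pointwise : ∀ z → point w 1 z + adjacency G y z + point y c z ≤ adjacency G x z + point x c z
  pointwise z with z ≟ w
  ... | yes refl rewrite point-≢ {a = y} c w≢y | point-≢ {a = x} c w≢x | xw | yw = ≤-refl
  ... | no _ with z ≟ y
  ...   | yes refl rewrite irrefl G z | point-≢ {a = x} c (x≢y ∘ sym) = m≤m+n c 0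
  ...   | no _ with z ≟ x
  ...     | yes refl rewrite irrefl G z | adj-sym G y z = ≤-reflexive (+-identityʳ c)
  ...     | no z≢x = +-monoˡ-≤ 0 (adjacency-mono G (N[y]⊆N[x] z z≢x))

AltC4Free : ∀ {n} → Graph n → Set
AltC4Free G = ∀ a b c d → adj G a b ≡ true → adj G c d ≡ true
            → adj G a c ≡ false → adj G b d ≡ false → a ≢ c → b ≢ d → ⊥

module _ {n} (G : Graph n) (noAltC4 : AltC4Free G) where

  nonadj⇒neighbours-⊆ : ∀ {x y w} → adj G x w ≡ true → adj G y w ≡ false → w ≢ y
                       → ∀ z → z ≢ x → adj G y z ≡ true → adj G x z ≡ true
  nonadj⇒neighbours-⊆ {x} {y} {w} xw yw w≢y z z≢x yz with adj G x z in xz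
  ... | true  = refl
  ... | false = ⊥-elim (noAltC4 w x y z (adj-flip G xw) yz (adj-flip G yw) xz w≢y (z≢x ∘ sym))

  deg-≤⇒adj : ∀ {x y w} → deg G x ≤ deg G y → adj G x w ≡ true → w ≢ y → adj G y w ≡ true
  deg-≤⇒adj {x} {y} {w} x≤y xw w≢y with adj G y w in yw
  ... | true  = refl
  ... | false = contradiction x≤y (<⇒≱ (neighbours-⊂⇒deg< G xw yw w≢y (nonadj⇒neighbours-⊆ xw yw w≢y)))

pair : ∀ {n} → Fin n → Fin n → Subset n
pair a c = ⁅ a ⁆ ∪ ⁅ c ⁆

∈-pair⁻ : ∀ {n} {a c x : Fin n} → x ∈ pair a c → x ≡ a ⊎ x ≡ c
∈-pair⁻ {a = a} {c} x∈ = Sum.map (x∈⁅y⁆⇒x≡y a) (x∈⁅y⁆⇒x≡y c) (x∈p∪q⁻ ⁅ a ⁆ ⁅ c ⁆ x∈)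

∈-pairˡ : ∀ {n} (a c : Fin n) → a ∈ pair a c
∈-pairˡ a c = x∈p∪q⁺ (inj₁ (x∈⁅x⁆ a))

∈-pairʳ : ∀ {n} (a c : Fin n) → c ∈ pair a c
∈-pairʳ a c = x∈p∪q⁺ (inj₂ (x∈⁅x⁆ c))

weight-sum : ∀ {n} (ℓ : Fin n → ℕ) X → weight ℓ X ≡ sum (λ v → if lookup X v then ℓ v else 0)
weight-sum ℓ X = sum-allFin (λ v → if lookup X v then ℓ v else 0)

weight-pair : ∀ {n} (ℓ : Fin n → ℕ) {a c} → a ≢ c → weight ℓ (pair a c) ≡ ℓ a + ℓ c
weight-pair ℓ {a} {c} a≢c = begin
  weight ℓ (pair a c)                              ≡⟨ weight-sum ℓ (pair a c) ⟩
  sum (λ v → if lookup (pair a c) v then ℓ v else 0) ≡⟨ sum-cong-≗ pointwise ⟩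
  sum (λ v → point a (ℓ a) v + point c (ℓ c) v)    ≡⟨ ∑-distrib-+ (point a (ℓ a)) (point c (ℓ c)) ⟩
  sum (point a (ℓ a)) + sum (point c (ℓ c))        ≡⟨ cong₂ _+_ (sum-point a (ℓ a)) (sum-point c (ℓ c)) ⟩
  ℓ a + ℓ c                                        ∎
  where
  open ≡-Reasoning
  pointwise : ∀ v → (if lookup (pair a c) v then ℓ v else 0) ≡ point a (ℓ a) v + point c (ℓ c) v
  pointwise v with lookup (pair a c) v in v∈
  ... | true with ∈-pair⁻ (lookup⇒[]= v (pair a c) v∈)
  ...   | inj₁ refl rewrite point-≡ v (ℓ v) | point-≢ {a = c} (ℓ c) a≢c = sym (+-identityʳ (ℓ v))
  ...   | inj₂ refl rewrite point-≡ v (ℓ v) | point-≢ {a = a} (ℓ a) (a≢c ∘ sym) = refl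
  pointwise v | false = sym (cong₂ _+_ (point-≢ (ℓ a) v≢a) (point-≢ (ℓ c) v≢c))
    where
    v≢a : v ≢ a
    v≢a refl = ≡true⇒≢false ([]=⇒lookup (∈-pairˡ a c)) v∈
    v≢c : v ≢ c
    v≢c refl = ≡true⇒≢false ([]=⇒lookup (∈-pairʳ a c)) v∈

pair-independent : ∀ {n} (G : Graph n) {a c} → adj G a c ≡ false → Independent G (pair a c)
pair-independent G ac x y x∈ y∈ with ∈-pair⁻ x∈ | ∈-pair⁻ y∈
... | inj₁ refl | inj₁ refl = irrefl G x
... | inj₁ refl | inj₂ refl = ac
... | inj₂ refl | inj₁ refl = adj-flip G ac
... | inj₂ refl | inj₂ refl = irrefl G x

weight-mono-⊆ : ∀ {n} (ℓ : Fin n → ℕ) {X Y} → X ⊆ Y → weight ℓ X ≤ weight ℓ Y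
weight-mono-⊆ ℓ {X} {Y} X⊆Y = begin
  weight ℓ X                                  ≡⟨ weight-sum ℓ X ⟩
  sum (λ v → if lookup X v then ℓ v else 0)  ≤⟨ sum-mono-≤ pointwise ⟩
  sum (λ v → if lookup Y v then ℓ v else 0)  ≡⟨ weight-sum ℓ Y ⟨
  weight ℓ Y                                  ∎
  where
  open ≤-Reasoning
  pointwise : ∀ v → (if lookup X v then ℓ v else 0) ≤ (if lookup Y v then ℓ v else 0)
  pointwise v with lookup X v in v∈X
  ... | false = z≤n
  ... | true rewrite []=⇒lookup (X⊆Y (lookup⇒[]= v X v∈X)) = ≤-refl

threshold⇒altC4Free : ∀ {n} (G : Graph n) → Threshold G → AltC4Free G
threshold⇒altC4Free G (ℓ , t , independent⇔) a b c d ab cd ac bd a≢c b≢d =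
  <⇒≱ (begin-strict
    t + t                    <⟨ +-mono-< (adj⇒t< ab) (adj⇒t< cd) ⟩
    ℓ a + ℓ b + (ℓ c + ℓ d)  ≡⟨ interchange (ℓ a) (ℓ b) (ℓ c) (ℓ d) ⟩
    ℓ a + ℓ c + (ℓ b + ℓ d)  ∎)
  (+-mono-≤ (nonadj⇒≤t a≢c ac) (nonadj⇒≤t b≢d bd))
  where
  open ≤-Reasoning
  nonadj⇒≤t : ∀ {x y} → x ≢ y → adj G x y ≡ false → ℓ x + ℓ y ≤ t
  nonadj⇒≤t x≢y xy =
    subst (_≤ t) (weight-pair ℓ x≢y) (Equivalence.to (independent⇔ _) (pair-independent G xy))
  adj⇒t< : ∀ {x y} → adj G x y ≡ true → t < ℓ x + ℓ y
  adj⇒t< {x} {y} xy = ≰⇒> λ ≤t →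
    let independent = Equivalence.from (independent⇔ _) (subst (_≤ t) (sym (weight-pair ℓ (adj⇒≢ G xy))) ≤t)
    in  ≡true⇒≢false xy (independent x y (∈-pairˡ x y) (∈-pairʳ x y))

-- Call x light if some non-neighbour w ≠ x has deg w ≥ deg x: light vertices are pairwise
-- non-adjacent, heavy ones pairwise adjacent.  A light x weighs (n+1)^deg x; a heavy k weighs
-- t minus the sum of (n+1)^deg w over its non-neighbours w, where t = 2·total + 1.  So an
-- independent set, which besides at most one heavy k holds only non-neighbours of k, weighs
-- at most t.  Two heavy vertices each weigh more than total, and for an edge uk with u light
-- and k heavy all non-neighbours of k have degree below deg u, so together they weigh less
-- than (n+1)^deg u.
module ThresholdWeights {n} (G : Graph n) (noAltC4 : AltC4Free G) where

  degPower : Fin n → ℕ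
  degPower x = suc n ^ deg G x

  Light : Fin n → Set
  Light x = ∃[ w ] (w ≢ x × adj G x w ≡ false × deg G x ≤ deg G w)

  light? : ∀ x → Dec (Light x)
  light? x = any? λ w → ¬? (w ≟ x) ×-dec (adj G x w Bool.≟ false) ×-dec (deg G x ≤? deg G w)

  nonNeighbourPower : Fin n → Fin n → ℕ
  nonNeighbourPower k w = if adj G k w then 0 else if ⌊ w ≟ k ⌋ then 0 else degPower w

  nonNeighbourSum : Fin n → ℕ
  nonNeighbourSum k = sum (nonNeighbourPower k)

  total : ℕ
  total = sum degPower

  t : ℕ
  t = suc (total + total)

  ℓ : Fin n → ℕ
  ℓ x with light? x
  ... | yes _ = degPower x
  ... | no _  = t ∸ nonNeighbourSum x

  ℓ-light : ∀ {x} → Light x → ℓ x ≡ degPower x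
  ℓ-light {x} light with light? x
  ... | yes _    = refl
  ... | no heavy = contradiction light heavy

  ℓ-heavy : ∀ {x} → ¬ Light x → ℓ x ≡ t ∸ nonNeighbourSum x
  ℓ-heavy {x} heavy with light? x
  ... | yes light = contradiction light heavy
  ... | no _      = refl

  adj⇒nonadj-deg< : ∀ {k i w} → adj G k i ≡ true → adj G k w ≡ false → w ≢ k → deg G w < deg G i
  adj⇒nonadj-deg< ki kw w≢k =
    ≰⇒> λ i≤w → ≡true⇒≢false (adj-flip G (deg-≤⇒adj G noAltC4 i≤w (adj-flip G ki) (w≢k ∘ sym))) kw

  light-adj⇒deg< : ∀ {x y} → Light x → adj G x y ≡ true → deg G x < deg G y
  light-adj⇒deg< (w , w≢x , xw , x≤w) xy = ≤-<-trans x≤w (adj⇒nonadj-deg< xy xw w≢x)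

  heavy-adj : ∀ {k k′} → ¬ Light k → ¬ Light k′ → k ≢ k′ → adj G k k′ ≡ true
  heavy-adj {k} {k′} heavy heavy′ k≢k′ with adj G k k′ in kk′
  ... | true  = refl
  ... | false = contradiction (nonadj-deg< heavy (k≢k′ ∘ sym) kk′)
                              (<-asym (nonadj-deg< heavy′ k≢k′ (adj-flip G kk′)))
    where
    nonadj-deg< : ∀ {x w} → ¬ Light x → w ≢ x → adj G x w ≡ false → deg G w < deg G x
    nonadj-deg< heavy w≢x xw = ≰⇒> λ x≤w → heavy (_ , w≢x , xw , x≤w)

  nonNeighbourPower≤degPower : ∀ k w → nonNeighbourPower k w ≤ degPower w
  nonNeighbourPower≤degPower k w with adj G k w | ⌊ w ≟ k ⌋
  ... | true  | _     = z≤n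
  ... | false | true  = z≤n
  ... | false | false = ≤-refl

  nonNeighbourSum≤total : ∀ k → nonNeighbourSum k ≤ total
  nonNeighbourSum≤total k = sum-mono-≤ (nonNeighbourPower≤degPower k)

  nonNeighbourSum≤t : ∀ k → nonNeighbourSum k ≤ t
  nonNeighbourSum≤t k = ≤-trans (nonNeighbourSum≤total k) (≤-trans (m≤m+n total total) (n≤1+n _))

  nonNeighbourSum<degPower : ∀ {k i} → adj G k i ≡ true → nonNeighbourSum k < degPower i
  nonNeighbourSum<degPower {k} {i} ki with deg G i in degi | adj⇒deg>0 G (adj-flip G ki)
  ... | suc d | _ = sum-<-^ {d = d} bound
    where
    bound : ∀ w → nonNeighbourPower k w ≤ suc n ^ d
    bound w with adj G k w in kw | w ≟ k
    ... | true  | _       = z≤n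
    ... | false | yes _   = z≤n
    ... | false | no w≢k  = ^-monoʳ-≤ (suc n) (≤-pred (subst (deg G w <_) degi (adj⇒nonadj-deg< ki kw w≢k)))

  total<t∸nonNeighbourSum : ∀ k → total < t ∸ nonNeighbourSum k
  total<t∸nonNeighbourSum k = begin-strict
    total                     <⟨ n<1+n total ⟩
    suc total                 ≡⟨ m+n∸n≡m (suc total) total ⟨
    t ∸ total                 ≤⟨ ∸-monoʳ-≤ t (nonNeighbourSum≤total k) ⟩
    t ∸ nonNeighbourSum k     ∎
    where open ≤-Reasoning

  t<light+heavy : ∀ {u v} → adj G v u ≡ true → t < degPower u + (t ∸ nonNeighbourSum v)
  t<light+heavy {u} {v} vu = begin-strict
    t                                              ≡⟨ m∸n+n≡m (nonNeighbourSum≤t v) ⟨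
    t ∸ nonNeighbourSum v + nonNeighbourSum v      <⟨ +-monoʳ-< (t ∸ nonNeighbourSum v) (nonNeighbourSum<degPower vu) ⟩
    t ∸ nonNeighbourSum v + degPower u             ≡⟨ +-comm (t ∸ nonNeighbourSum v) (degPower u) ⟩
    degPower u + (t ∸ nonNeighbourSum v)           ∎
    where open ≤-Reasoning

  adj⇒t<ℓ+ℓ : ∀ {u v} → adj G u v ≡ true → t < ℓ u + ℓ v
  adj⇒t<ℓ+ℓ {u} {v} uv with light? u | light? v
  ... | yes lu | yes lv = contradiction (light-adj⇒deg< lu uv) (<-asym (light-adj⇒deg< lv (adj-flip G uv)))
  ... | yes _  | no _   = t<light+heavy (adj-flip G uv)
  ... | no _   | yes _  = subst (t <_) (+-comm (degPower v) (t ∸ nonNeighbourSum u)) (t<light+heavy uv)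
  ... | no _   | no _   = subst (_≤ (t ∸ nonNeighbourSum u) + (t ∸ nonNeighbourSum v)) (cong suc (+-suc total total))
                            (+-mono-≤ (total<t∸nonNeighbourSum u) (total<t∸nonNeighbourSum v))

  heavy-member⇒weight≤t : ∀ {X k} → Independent G X → k ∈ X → ¬ Light k → weight ℓ X ≤ t
  heavy-member⇒weight≤t {X} {k} independent k∈X heavy = begin
    weight ℓ X                                                ≡⟨ weight-sum ℓ X ⟩
    sum (λ z → if lookup X z then ℓ z else 0)                 ≤⟨ sum-mono-≤ pointwise ⟩
    sum (λ z → point k (ℓ k) z + nonNeighbourPower k z)       ≡⟨ ∑-distrib-+ (point k (ℓ k)) (nonNeighbourPower k) ⟩
    sum (point k (ℓ k)) + nonNeighbourSum k                   ≡⟨ cong (_+ nonNeighbourSum k) (trans (sum-point k (ℓ k)) (ℓ-heavy heavy)) ⟩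
    t ∸ nonNeighbourSum k + nonNeighbourSum k                 ≡⟨ m∸n+n≡m (nonNeighbourSum≤t k) ⟩
    t                                                         ∎
    where
    open ≤-Reasoning
    pointwise : ∀ z → (if lookup X z then ℓ z else 0) ≤ point k (ℓ k) z + nonNeighbourPower k z
    pointwise z with z ≟ k
    ... | yes refl rewrite []=⇒lookup k∈X = m≤m+n (ℓ z) _
    ... | no z≢k with lookup X z in z∈X
    ...   | false = z≤n
    ...   | true with light? z
    ...     | no heavy′ = contradiction (heavy-adj heavy heavy′ (z≢k ∘ sym)) λ kz →
                            ≡true⇒≢false kz (independent k z k∈X (lookup⇒[]= z X z∈X))
    ...     | yes _ rewrite independent k z k∈X (lookup⇒[]= z X z∈X) = ≤-refl

  light-members⇒weight≤t : ∀ {X} → (∀ z → z ∈ X → Light z) → weight ℓ X ≤ t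
  light-members⇒weight≤t {X} allLight = begin
    weight ℓ X                                   ≡⟨ weight-sum ℓ X ⟩
    sum (λ z → if lookup X z then ℓ z else 0)    ≤⟨ sum-mono-≤ pointwise ⟩
    total                                        ≤⟨ m≤m+n total total ⟩
    total + total                                ≤⟨ n≤1+n _ ⟩
    t                                            ∎
    where
    open ≤-Reasoning
    pointwise : ∀ z → (if lookup X z then ℓ z else 0) ≤ degPower z
    pointwise z with lookup X z in z∈X
    ... | false = z≤n
    ... | true  = ≤-reflexive (ℓ-light (allLight z (lookup⇒[]= z X z∈X)))

  independent⇒weight≤t : ∀ {X} → Independent G X → weight ℓ X ≤ t
  independent⇒weight≤t {X} independent with any? (λ k → (k ∈? X) ×-dec ¬? (light? k))
  ... | yes (k , k∈X , heavy) = heavy-member⇒weight≤t independent k∈X heavy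
  ... | no noHeavy = light-members⇒weight≤t λ z z∈X → decidable-stable (light? z) λ heavy → noHeavy (z , z∈X , heavy)

  weight≤t⇒independent : ∀ {X} → weight ℓ X ≤ t → Independent G X
  weight≤t⇒independent {X} ≤t u v u∈X v∈X with adj G u v in uv
  ... | false = refl
  ... | true  = contradiction ≤t (<⇒≱ (begin-strict
    t                    <⟨ adj⇒t<ℓ+ℓ uv ⟩
    ℓ u + ℓ v            ≡⟨ weight-pair ℓ (adj⇒≢ G uv) ⟨
    weight ℓ (pair u v)  ≤⟨ weight-mono-⊆ ℓ pair⊆X ⟩
    weight ℓ X           ∎))
    where
    open ≤-Reasoning
    pair⊆X : pair u v ⊆ X
    pair⊆X x∈ with ∈-pair⁻ x∈
    ... | inj₁ refl = u∈X
    ... | inj₂ refl = v∈X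

  threshold : Threshold G
  threshold = ℓ , t , λ X → mk⇔ independent⇒weight≤t weight≤t⇒independent

altC4Free⇒threshold : ∀ {n} (G : Graph n) → AltC4Free G → Threshold G
altC4Free⇒threshold G noAltC4 = ThresholdWeights.threshold G noAltC4

module _ {n} (G : Graph n) {u v : Fin n} where

  private
    G-uv = deleteEdge G u v

  deleteEdge-adj⇒adj : ∀ {x y} → adj G-uv x y ≡ true → adj G x y ≡ true
  deleteEdge-adj⇒adj {x} {y} xy with adj G x y
  ... | true  = refl
  ... | false = xy

  deleteEdge-nonadj : ∀ {x y} → adj G-uv x y ≡ false
                    → adj G x y ≡ false ⊎ (x ≡ u × y ≡ v) ⊎ (x ≡ v × y ≡ u)
  deleteEdge-nonadj {x} {y} xy with adj G x y | x ≟ u | y ≟ v | x ≟ v | y ≟ u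
  ... | false | _       | _       | _       | _       = inj₁ refl
  ... | true  | yes x≡u | yes y≡v | _       | _       = inj₂ (inj₁ (x≡u , y≡v))
  ... | true  | _       | _       | yes x≡v | yes y≡u = inj₂ (inj₂ (x≡v , y≡u))
  ... | true  | no _    | _       | no _    | _       = contradiction xy λ ()
  ... | true  | no _    | _       | yes _   | no _    = contradiction xy λ ()
  ... | true  | yes _   | no _    | no _    | _       = contradiction xy λ ()
  ... | true  | yes _   | no _    | yes _   | no _    = contradiction xy λ ()

  deleteEdge-uv : adj G-uv u v ≡ false
  deleteEdge-uv with adj G u v | u ≟ u | v ≟ v
  ... | false | _       | _       = refl
  ... | true  | yes _   | yes _   = refl
  ... | true  | no u≢u  | _       = contradiction refl u≢u
  ... | true  | _       | no v≢v  = contradiction refl v≢v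

module _ {n} (G : Graph n) (F : EdgeSet G) where

  delete-adj : ∀ {x y} → adj G x y ≡ true → mem F x y ≡ false → adj (delete G F) x y ≡ true
  delete-adj xy x≁y rewrite xy | x≁y = refl

  delete-nonadj : ∀ {x y} → adj G x y ≡ false → adj (delete G F) x y ≡ false
  delete-nonadj xy rewrite xy = refl

  delete-mem : ∀ {x y} → mem F x y ≡ true → adj (delete G F) x y ≡ false
  delete-mem {x} {y} xy∈F rewrite sub F x y xy∈F | xy∈F = refl

module _ {n} (G : Graph n) (F : EdgeSet G) (noAltC4 : AltC4Free G) (noAltC4-F : AltC4Free (delete G F))
         {u v : Fin n} (minimal : DegreeMinimal G F u v) where

  private
    G-uv = deleteEdge G u v
    uv∈F = proj₁ minimal
    u-minimal = proj₁ (proj₂ minimal)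
    v-minimal = proj₂ (proj₂ minimal)

  no-altC4-with-nonedge-uv : ∀ {b d} → adj G-uv u b ≡ true → adj G-uv v d ≡ true
                           → adj G-uv b d ≡ false → b ≢ d → ⊥
  no-altC4-with-nonedge-uv {b} {d} ub vd bd b≢d = by-membership
    where
    ubG = deleteEdge-adj⇒adj G ub
    vdG = deleteEdge-adj⇒adj G vd
    bdG : adj G b d ≡ false
    bdG with deleteEdge-nonadj G bd
    ... | inj₁ bd′                = bd′
    ... | inj₂ (inj₁ (refl , _)) = contradiction refl (adj⇒≢ G ubG)
    ... | inj₂ (inj₂ (refl , _)) = contradiction (deleteEdge-uv G) (≡true⇒≢false ub)
    by-membership : ⊥
    by-membership with mem F u b in ub∈F | mem F v d in vd∈F
    ... | true  | _     = ≡true⇒≢false (deg-≤⇒adj G noAltC4 (v-minimal b ub∈F) vdG (b≢d ∘ sym)) bdG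
    ... | false | true  = ≡true⇒≢false (deg-≤⇒adj G noAltC4 (u-minimal d v (trans (memSym F d v) vd∈F)) ubG b≢d)
                                      (adj-flip G bdG)
    ... | false | false = noAltC4-F u b v d (delete-adj G F ubG ub∈F) (delete-adj G F vdG vd∈F)
                            (delete-mem G F uv∈F) (delete-nonadj G F bdG) (adj⇒≢ G (sub F u v uv∈F)) b≢d

  deleteEdge-altC4Free : AltC4Free G-uv
  deleteEdge-altC4Free a b c d ab cd ac bd a≢c b≢d with deleteEdge-nonadj G ac | deleteEdge-nonadj G bd
  ... | inj₁ acG | inj₁ bdG =
    noAltC4 a b c d (deleteEdge-adj⇒adj G ab) (deleteEdge-adj⇒adj G cd) acG bdG a≢c b≢d
  ... | inj₂ (inj₁ (refl , refl)) | _ = no-altC4-with-nonedge-uv ab cd bd b≢d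
  ... | inj₂ (inj₂ (refl , refl)) | _ = no-altC4-with-nonedge-uv cd ab (adj-flip G-uv bd) (b≢d ∘ sym)
  ... | inj₁ _ | inj₂ (inj₁ (refl , refl)) = no-altC4-with-nonedge-uv (adj-flip G-uv ab) (adj-flip G-uv cd) ac a≢c
  ... | inj₁ _ | inj₂ (inj₂ (refl , refl)) =
    no-altC4-with-nonedge-uv (adj-flip G-uv cd) (adj-flip G-uv ab) (adj-flip G-uv ac) (a≢c ∘ sym)

theorem4p5 : ∀ (n : ℕ) (G : Graph n) (F : EdgeSet G) → Threshold G → Threshold (delete G F)
           → ∀ (u v : Fin n) → DegreeMinimal G F u v → Threshold (deleteEdge G u v)
theorem4p5 n G F thresholdG thresholdG-F u v minimal =
  altC4Free⇒threshold (deleteEdge G u v)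
    (deleteEdge-altC4Free G F (threshold⇒altC4Free G thresholdG)
                              (threshold⇒altC4Free (delete G F) thresholdG-F) minimal)
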